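{- Let $G$ be a signed graph with source $u_1$, sink $u_2$, and vertices $w_1$ and $w_2$. Then $[u_1u_2,w_1w_2]_D=-[u_1u_2,w_2w_1]_D=-[u_2u_1,w_1w_2]_D$.
   Context: A signed graph is an oriented hypergraph (vertices $V$, edges $E$, incidences $I$, maps $\varsigma:I\to V$, $\omega:I\to E$, orientation $\sigma:I\to\{\pm1\}$) in which every edge has exactly two incidences. An adjacency is an ordered pair $(i,j)$ of distinct incidences of one edge, from $\varsigma(i)$ to $\varsigma(j)$, with sign $-\sigma(i)\sigma(j)$; a backstep at $v$ uses one incidence $i$ at $v$ twice. For sequences $\mathbf u=(u_1,\dots,u_k)$, $\mathbf w=(w_1,\dots,w_k)$ of vertices, $U=\{u_i\}$, the set $\widehat{\mathfrak{C}}_{\neq0}(L^0(G);\mathbf u,\mathbf w)$ consists of assignments $c$ choosing, for each $v\in V\setminus U$, an adjacency of $G$ starting at $v$ or a backstep at $v$, such that the rule $\pi_c(v)=$ head of the step at $v$ for $v\notin U$, $\pi_c(u_i)=w_i$, defines a bijection $\pi_c:V\to V$. $\check c$ is $c$ with the formal arcs $u_i\to w_i$; $ec(\check c)$ is the number of cycles of $\pi_c$ of even length; $bs(c)$ is the number of backsteps of $c$; $nc(c)$ is the number of components of $c$ (connected components of the graph on $V$ formed by the steps of $c$, formal arcs excluded) whose product of adjacency signs is $-1$. $\mathrm{sgn}_D(c)=(-1)^{ec(\check c)+nc(c)+bs(c)}$ and $[u_1u_2,w_1w_2]_D=\sum_{c\in\widehat{\mathfrak{C}}_{\neq0}(L^0(G);(u_1,u_2),(w_1,w_2))}\mathrm{sgn}_D(c)$.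 -}

module Defs where

open import Data.Bool using (Bool; true; false; _∧_; _∨_; not; if_then_else_)
open import Data.Nat using (ℕ; zero; suc; _+_; _≤ᵇ_; _≡ᵇ_; _%_)
open import Data.Fin using (Fin; zero; suc; toℕ)
open import Data.Fin.Properties using (_≟_)
open import Data.Maybe using (Maybe; just; nothing)
open import Data.Product using (_×_; _,_)
open import Data.List using (List; []; _∷_; foldr; map; concatMap; cartesianProduct; allFin; filter; upTo; length)
open import Data.Bool.ListAction using (all; any)
open import Data.Bool.Properties renaming (_≟_ to _≟ᵇ_)
open import Data.Integer using (ℤ; +_; -_) renaming (_+_ to _+ℤ_)
open import Data.Sign using (Sign; opposite) renaming (_*_ to _*ˢ_)
import Data.Sign as S
open import Relation.Nullary using (does)

-- A signed graph: vertices Fin n, edges Fin m; every edge e has exactly two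
-- incidences, encoded as (e , 0) and (e , 1) : Fin m × Fin 2.
-- ς e k is the vertex of incidence (e , k); σ e k its orientation.
record SignedGraph : Set where
  field
    n : ℕ
    m : ℕ
    ς : Fin m → Fin 2 → Fin n
    σ : Fin m → Fin 2 → Sign

flip2 : Fin 2 → Fin 2
flip2 zero = suc zero
flip2 (suc _) = zero

-- A step: (true , e , k) is the adjacency ((e,k),(e,flip k));
--         (false , e , k) is the backstep at incidence (e,k).
Step : ℕ → Set
Step m = Bool × Fin m × Fin 2

_==_ : ∀ {n} → Fin n → Fin n → Bool
x == y = does (x ≟ y)

count : ∀ {n} → (Fin n → Bool) → ℕ
count {n} p = length (filter (λ i → p i ≟ᵇ true) (allFin n))

iter : ∀ {A : Set} → ℕ → (A → A) → A → A
iter zero f x = x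
iter (suc k) f x = f (iter k f x)

-- least k ≥ start (within fuel) with p k; default last tried value
search : (ℕ → Bool) → ℕ → ℕ → ℕ
search p zero k = k
search p (suc f) k = if p k then k else search p f (suc k)

isEven : ℕ → Bool
isEven k = (k % 2) ≡ᵇ 0

allFuns : ∀ {X : Set} (k : ℕ) → List X → List (Fin k → X)
allFuns zero xs = (λ ()) ∷ []
allFuns (suc k) xs =
  concatMap (λ x → map (λ f → λ { zero → x ; (suc i) → f i }) (allFuns k xs)) xs

module _ (G : SignedGraph) where
  open SignedGraph G

  start : Step m → Fin n
  start (_ , e , k) = ς e k

  head : Step m → Fin n
  head (true , e , k) = ς e (flip2 k)
  head (false , e , k) = ς e k

  adjSign : Fin m → Fin 2 → Sign
  adjSign e k = opposite (σ e k *ˢ σ e (flip2 k))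

  allSteps : List (Step m)
  allSteps = cartesianProduct (true ∷ false ∷ []) (cartesianProduct (allFin m) (allFin 2))

  -- an assignment c: c v = just s (the chosen step at v) for v ∉ U,
  -- c v = nothing for v ∈ U
  Assignment : Set
  Assignment = Fin n → Maybe (Step m)

  allAssignments : List Assignment
  allAssignments = allFuns n (nothing ∷ map just allSteps)

  module _ (u₁ u₂ w₁ w₂ : Fin n) (c : Assignment) where

    inU : Fin n → Bool
    inU v = (v == u₁) ∨ (v == u₂)

    π : Fin n → Fin n
    π v = if v == u₁ then w₁ else (if v == u₂ then w₂ else headOf (c v))
      where
      headOf : Maybe (Step m) → Fin n
      headOf (just s) = head s
      headOf nothing = v

    wellShaped : Bool
    wellShaped = all ok (allFin n)
      where
      ok : Fin n → Bool
      ok v with inU v | c v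
      ... | true  | nothing = true
      ... | true  | just _  = false
      ... | false | nothing = false
      ... | false | just s  = start s == v

    bijective : Bool
    bijective =
      all (λ x → all (λ y → not (π x == π y) ∨ (x == y)) (allFin n)) (allFin n)
      ∧ all (λ y → any (λ x → π x == y) (allFin n)) (allFin n)

    valid : Bool
    valid = wellShaped ∧ bijective

    -- ec: number of cycles of π of even length
    cycleLen : Fin n → ℕ
    cycleLen v = search (λ k → iter k π v == v) n 1

    cycleMin : Fin n → Bool
    cycleMin v = all (λ k → toℕ v ≤ᵇ toℕ (iter k π v)) (upTo (cycleLen v))

    ec : ℕ
    ec = count (λ v → cycleMin v ∧ isEven (cycleLen v))

    isBackstep : Maybe (Step m) → Bool
    isBackstep (just (false , _)) = true
    isBackstep _ = false

    bs : ℕ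
    bs = count (λ v → isBackstep (c v))

    linked : Fin n → Fin n → Bool
    linked x y = any lk (allFin n)
      where
      lk : Fin n → Bool
      lk v with c v
      ... | nothing = false
      ... | just s  = ((start s == x) ∧ (head s == y)) ∨ ((start s == y) ∧ (head s == x))

    reach : ℕ → Fin n → Fin n → Bool
    reach zero x y = x == y
    reach (suc k) x y = reach k x y ∨ any (λ z → reach k x z ∧ linked z y) (allFin n)

    conn : Fin n → Fin n → Bool
    conn = reach n

    compMin : Fin n → Bool
    compMin r = all (λ x → not (conn r x) ∨ (toℕ r ≤ᵇ toℕ x)) (allFin n)

    isNegAdj : Maybe (Step m) → Bool
    isNegAdj (just (true , e , k)) with adjSign e k
    ... | S.- = true
    ... | S.+ = false
    isNegAdj _ = false

    -- nc: components whose product of adjacency signs is -1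
    -- (the step chosen at v lies in the component of v)
    nc : ℕ
    nc = count (λ r → compMin r ∧ not (isEven (count (λ v → conn r v ∧ isNegAdj (c v)))))

    sgnD : ℤ
    sgnD = if isEven (ec + nc + bs) then + 1 else - (+ 1)

  bracketD : Fin n → Fin n → Fin n → Fin n → ℤ
  bracketD u₁ u₂ w₁ w₂ =
    foldr _+ℤ_ (+ 0) (map (sgnD u₁ u₂ w₁ w₂) (filter (λ c → valid u₁ u₂ w₁ w₂ c ≟ᵇ true) allAssignments))

module Submission where

-- Fix an assignment c. Swapping w₁ and w₂, or u₁ and u₂, leaves the steps of c, hence bs
-- and nc, untouched and does not change which assignments are admissible; it only replaces
-- π_c by π_c ∘ (u₁ u₂). Composing a permutation with a transposition (a b) either splits
-- the cycle through a and b, of length L, into two cycles of lengths p and L − p, or merges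
-- two cycles into one. Among p, L − p and L an odd number are even, so the number ec of
-- even cycles changes parity and every term of the bracket changes sign.

open import Defs
open import Data.Bool using (Bool; true; false; T; _∧_; _∨_; not; if_then_else_)
open import Data.Bool.Properties
  using (T-≡; T-not-≡; T-∧; T-∨; not-involutive; ∨-comm; ∧-identityʳ; ∧-zeroʳ)
  renaming (_≟_ to _≟ᵇ_)
open import Data.Bool.ListAction using (all; any; and)
open import Data.Empty using (⊥; ⊥-elim)
open import Data.Fin using (Fin; zero; suc; toℕ)
open import Data.Fin.Properties using (_≟_; toℕ-injective; toℕ<n; pigeonhole)
open import Data.Fin.Permutation.Components using (transpose; transpose-inverse)
open import Data.Integer using (ℤ; +_; -_) renaming (_+_ to _+ℤ_)
open import Data.Integer.Properties using (neg-distrib-+)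
open import Data.List using (List; []; _∷_; foldr; map; filter; length; tabulate; allFin; upTo)
open import Data.List.Properties using (map-cong)
import Data.List.Relation.Unary.All.Properties as All
import Data.List.Relation.Unary.Any.Properties as Any
open import Data.List.Relation.Unary.All.Properties.Core using (¬All⇒Any¬)
open import Data.List.Relation.Unary.All using (lookup)
open import Data.List.Membership.Propositional.Properties using (∈-upTo⁺)
open import Data.List.Extrema.Nat using (argmin; f[argmin]≤f[xs])
open import Data.Maybe using (Maybe; just; nothing)
open import Data.Nat using (ℕ; zero; suc; _+_; _∸_; _≤_; _<_; z≤n; s≤s; _≤ᵇ_; _≡ᵇ_; _≤?_) renaming (_≟_ to _≟ℕ_)
open import Data.Nat.DivMod using ([m+n]%n≡m%n)
open import Data.Nat.Properties hiding (_≟_)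
open import Data.Product using (∃; _×_; _,_; proj₁; proj₂)
open import Data.Sum using (_⊎_; inj₁; inj₂; [_,_]′)
import Data.Sum as Sum
open import Function using (_∘_; Equivalence; Injective)
open import Relation.Binary using (tri<; tri≈; tri>)
open import Relation.Binary.PropositionalEquality
open import Relation.Nullary using (yes; no; ¬_; contradiction)
open import Relation.Nullary.Decidable using (dec-true; dec-false; T?)

-- Counting and parity

==⇒≡ : ∀ {k} {x y : Fin k} → T (x == y) → x ≡ y
==⇒≡ {x = x} {y} t with x ≟ y
... | yes x≡y = x≡y

≡⇒== : ∀ {k} {x y : Fin k} → x ≡ y → T (x == y)
≡⇒== {x = x} {y} x≡y = Equivalence.from T-≡ (dec-true (x ≟ y) x≡y)

≢⇒==-false : ∀ {k} {x y : Fin k} → x ≢ y → (x == y) ≡ false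
≢⇒==-false {x = x} {y} = dec-false (x ≟ y)

T-injective : ∀ {a b : Bool} → (T a → T b) → (T b → T a) → a ≡ b
T-injective {false} {false} _ _ = refl
T-injective {false} {true}  _ g = ⊥-elim (g _)
T-injective {true}  {false} f _ = ⊥-elim (f _)
T-injective {true}  {true}  _ _ = refl

bit : Bool → ℕ
bit true  = 1
bit false = 0

tally : ∀ {k} → (Fin k → Bool) → ℕ
tally {zero}  p = 0
tally {suc k} p = bit (p zero) + tally (p ∘ suc)

count-tabulate : ∀ {A : Set} {k} (f : Fin k → A) (q : A → Bool) →
                 length (filter (λ a → q a ≟ᵇ true) (tabulate f)) ≡ tally (q ∘ f)
count-tabulate {k = zero}  f q = refl
count-tabulate {k = suc k} f q with q (f zero)
... | true  = cong suc (count-tabulate (f ∘ suc) q)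
... | false = count-tabulate (f ∘ suc) q

count≡tally : ∀ {k} (p : Fin k → Bool) → count p ≡ tally p
count≡tally p = count-tabulate (λ i → i) p

tally-cong : ∀ {k} {p q : Fin k → Bool} → (∀ i → p i ≡ q i) → tally p ≡ tally q
tally-cong {zero}  p≗q = refl
tally-cong {suc k} p≗q = cong₂ _+_ (cong bit (p≗q zero)) (tally-cong (p≗q ∘ suc))

tally-false : ∀ {k} (p : Fin k → Bool) → (∀ i → p i ≡ false) → tally p ≡ 0
tally-false {k} p p≗false = trans (tally-cong {q = λ _ → false} p≗false) (all-false k)
  where
  all-false : ∀ k → tally {k} (λ _ → false) ≡ 0
  all-false zero    = refl
  all-false (suc k) = all-false k

tally-split : ∀ {k} (q p : Fin k → Bool) →
              tally p ≡ tally (λ i → q i ∧ p i) + tally (λ i → not (q i) ∧ p i)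
tally-split {zero}  q p = refl
tally-split {suc k} q p with q zero | p zero | tally-split (q ∘ suc) (p ∘ suc)
... | true  | true  | ih = cong suc ih
... | true  | false | ih = ih
... | false | true  | ih = trans (cong suc ih) (sym (+-suc _ _))
... | false | false | ih = ih

tally-singleton : ∀ {k} (p : Fin k → Bool) (i₀ : Fin k) → (∀ i → p i ≡ (i == i₀)) → tally p ≡ 1
tally-singleton {suc k} p zero p≗ rewrite p≗ zero =
  cong suc (tally-false (p ∘ suc) (p≗ ∘ suc))
tally-singleton {suc k} p (suc i₀) p≗ rewrite p≗ zero =
  tally-singleton (p ∘ suc) i₀ λ i → trans (p≗ (suc i)) (suc-== i i₀)
  where
  suc-== : ∀ {k} (i j : Fin k) → (suc i == suc j) ≡ (i == j)
  suc-== i j with i ≟ j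
  ... | yes refl = refl
  ... | no _     = refl

tally-∨ : ∀ {k} (p q r : Fin k → Bool) → (∀ i → T (p i) → T (q i) → ⊥) →
          tally (λ i → (p i ∨ q i) ∧ r i) ≡ tally (λ i → p i ∧ r i) + tally (λ i → q i ∧ r i)
tally-∨ {zero}  p q r disjoint = refl
tally-∨ {suc k} p q r disjoint
  with p zero | q zero | r zero | disjoint zero | tally-∨ (p ∘ suc) (q ∘ suc) (r ∘ suc) (disjoint ∘ suc)
... | true  | true  | _     | both | _  = ⊥-elim (both _ _)
... | true  | false | true  | _    | ih = cong suc ih
... | true  | false | false | _    | ih = ih
... | false | true  | true  | _    | ih = trans (cong suc ih) (sym (+-suc _ _))
... | false | true  | false | _    | ih = ih
... | false | false | _     | _    | ih = ih

even : ℕ → Bool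
even zero    = true
even (suc k) = not (even k)

isEven≡even : ∀ k → isEven k ≡ even k
isEven≡even zero          = refl
isEven≡even (suc zero)    = refl
isEven≡even (suc (suc k)) = begin
  isEven (2 + k)          ≡⟨ cong isEven (+-comm 2 k) ⟩
  isEven (k + 2)          ≡⟨ cong (_≡ᵇ 0) ([m+n]%n≡m%n k 2) ⟩
  isEven k                ≡⟨ isEven≡even k ⟩
  even k                  ≡⟨ not-involutive (even k) ⟨
  even (2 + k)            ∎
  where open ≡-Reasoning

even-+ : ∀ a b → even (a + b) ≡ (if even a then even b else not (even b))
even-+ zero    b = refl
even-+ (suc a) b rewrite even-+ a b with even a
... | true  = refl
... | false = not-involutive (even b)

even-+-flip : ∀ a a′ c → even a′ ≡ not (even a) → even (a′ + c) ≡ not (even (a + c))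
even-+-flip a a′ c e rewrite even-+ a′ c | even-+ a c | e with even a
... | true  = refl
... | false = sym (not-involutive (even c))

even-split-cycle : ∀ p q → even (bit (isEven q) + bit (isEven p)) ≡ not (even (bit (isEven (q + p))))
even-split-cycle p q rewrite isEven≡even p | isEven≡even q | isEven≡even (q + p) | even-+ q p
  with even p | even q
... | true  | true  = refl
... | true  | false = refl
... | false | true  = refl
... | false | false = refl

all-allFin⁻ : ∀ {k} (p : Fin k → Bool) → T (all p (allFin k)) → ∀ i → T (p i)
all-allFin⁻ p h = All.tabulate⁻ (All.all⁺ p _ h)

all-allFin⁺ : ∀ {k} (p : Fin k → Bool) → (∀ i → T (p i)) → T (all p (allFin k))
all-allFin⁺ p h = All.all⁻ p (All.tabulate⁺ h)

any-allFin⁻ : ∀ {k} (p : Fin k → Bool) → T (any p (allFin k)) → ∃ λ i → T (p i)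
any-allFin⁻ p h = Any.tabulate⁻ (Any.any⁻ p _ h)

any-allFin⁺ : ∀ {k} (p : Fin k → Bool) (i : Fin k) → T (p i) → T (any p (allFin k))
any-allFin⁺ p i h = Any.any⁺ p (Any.tabulate⁺ i h)

all-upTo⁻ : ∀ (p : ℕ → Bool) L → T (all p (upTo L)) → ∀ {i} → i < L → T (p i)
all-upTo⁻ p L h = All.applyUpTo⁻ _ L (All.all⁺ p _ h)

all-upTo⁺ : ∀ (p : ℕ → Bool) L → (∀ {i} → i < L → T (p i)) → T (all p (upTo L))
all-upTo⁺ p L h = All.all⁻ p (All.applyUpTo⁺₁ _ L h)

any-upTo⁻ : ∀ (p : ℕ → Bool) L → T (any p (upTo L)) → ∃ λ i → i < L × T (p i)
any-upTo⁻ p L h = Any.applyUpTo⁻ _ (Any.any⁻ p _ h)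

any-upTo⁺ : ∀ (p : ℕ → Bool) {L i} → i < L → T (p i) → T (any p (upTo L))
any-upTo⁺ p i<L h = Any.any⁺ p (Any.applyUpTo⁺ _ h i<L)

search-least : (p : ℕ → Bool) (fuel s j : ℕ) → s ≤ j → j < s + fuel → T (p j) →
               let r = search p fuel s in
               s ≤ r × T (p r) × (∀ {i} → s ≤ i → i < r → ¬ T (p i))
search-least p zero s j s≤j j<s+0 pj =
  contradiction (subst (j <_) (+-identityʳ s) j<s+0) (≤⇒≯ s≤j)
search-least p (suc fuel) s j s≤j j<s+fuel pj with p s in ps
... | true  = ≤-refl , Equivalence.from T-≡ ps , λ s≤i i<s → contradiction i<s (≤⇒≯ s≤i)
... | false
  with s<r , pr , below ← search-least p fuel (suc s) j (≤∧≢⇒< s≤j λ { refl → subst T ps pj })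
                                        (subst (j <_) (+-suc s fuel) j<s+fuel) pj
  = <⇒≤ s<r , pr , below-from-s below
  where
  below-from-s : ∀ {r} → (∀ {i} → suc s ≤ i → i < r → ¬ T (p i)) → ∀ {i} → s ≤ i → i < r → ¬ T (p i)
  below-from-s below {i} s≤i i<r with i ≟ℕ s
  ... | yes refl = subst T ps
  ... | no  i≢s  = below (≤∧≢⇒< s≤i (i≢s ∘ sym)) i<r

search-cong : ∀ {p q : ℕ → Bool} → (∀ i → p i ≡ q i) → ∀ fuel s → search p fuel s ≡ search q fuel s
search-cong p≗q zero       s = refl
search-cong {p} {q} p≗q (suc fuel) s rewrite p≗q s with q s
... | true  = refl
... | false = search-cong p≗q fuel (suc s)

iter-+ : ∀ {A : Set} (f : A → A) a b x → iter (a + b) f x ≡ iter a f (iter b f x)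
iter-+ f zero    b x = refl
iter-+ f (suc a) b x = cong f (iter-+ f a b x)

iter-comm : ∀ {A : Set} (f : A → A) a b x → iter a f (iter b f x) ≡ iter b f (iter a f x)
iter-comm f a b x = begin
  iter a f (iter b f x) ≡⟨ iter-+ f a b x ⟨
  iter (a + b) f x      ≡⟨ cong (λ c → iter c f x) (+-comm a b) ⟩
  iter (b + a) f x      ≡⟨ iter-+ f b a x ⟩
  iter b f (iter a f x) ∎
  where open ≡-Reasoning

-- Cycles of a permutation of Fin k

-- Defs' cycleLen, cycleMin and ec with π_c abstracted to an arbitrary f: ec G u₁ u₂ w₁ w₂ c
-- is definitionally evenCycleCount (π G u₁ u₂ w₁ w₂ c).
orbitLength : ∀ {k} → (Fin k → Fin k) → Fin k → ℕ
orbitLength {k} f v = search (λ i → iter i f v == v) k 1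

isOrbitMinimum : ∀ {k} → (Fin k → Fin k) → Fin k → Bool
isOrbitMinimum f v = all (λ i → toℕ v ≤ᵇ toℕ (iter i f v)) (upTo (orbitLength f v))

startsEvenCycle : ∀ {k} → (Fin k → Fin k) → Fin k → Bool
startsEvenCycle f v = isOrbitMinimum f v ∧ isEven (orbitLength f v)

evenCycleCount : ∀ {k} → (Fin k → Fin k) → ℕ
evenCycleCount f = count (startsEvenCycle f)

inOrbit : ∀ {k} → (Fin k → Fin k) → Fin k → Fin k → Bool
inOrbit f v x = any (λ i → iter i f v == x) (upTo (orbitLength f v))

module Orbit {k} {f : Fin k → Fin k} (f-injective : Injective _≡_ _≡_ f) where

  iter-injective : ∀ i → Injective _≡_ _≡_ (iter i f)
  iter-injective zero    e = e
  iter-injective (suc i) e = iter-injective i (f-injective e)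

  iter-∸ : ∀ {i j} v → i ≤ j → iter (j ∸ i) f (iter i f v) ≡ iter j f v
  iter-∸ {i} {j} v i≤j = trans (sym (iter-+ f (j ∸ i) i v)) (cong (λ c → iter c f v) (m∸n+n≡m i≤j))

  iter-cancel : ∀ {i j} v → i < j → iter j f v ≡ iter i f v → iter (j ∸ i) f v ≡ v
  iter-cancel {i} {j} v i<j fʲv≡fⁱv =
    iter-injective i (trans (iter-comm f i (j ∸ i) v) (trans (iter-∸ v (<⇒≤ i<j)) fʲv≡fⁱv))

  recurrence : ∀ v → ∃ λ j → 1 ≤ j × j ≤ k × iter j f v ≡ v
  recurrence v with i , j , i<j , fⁱv≡fʲv ← pigeonhole (n<1+n k) (λ (i : Fin (suc k)) → iter (toℕ i) f v) =
    toℕ j ∸ toℕ i , m<n⇒0<n∸m i<j , ≤-trans (m∸n≤m (toℕ j) (toℕ i)) (≤-pred (toℕ<n j)) ,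
    iter-cancel v i<j (sym fⁱv≡fʲv)

  private
    orbitLength-least : ∀ v → let L = orbitLength f v in
                        1 ≤ L × T (iter L f v == v) × (∀ {i} → 1 ≤ i → i < L → ¬ T (iter i f v == v))
    orbitLength-least v with j , 1≤j , j≤k , fʲv≡v ← recurrence v =
      search-least _ k 1 j 1≤j (s≤s j≤k) (≡⇒== fʲv≡v)

  orbitLength-positive : ∀ v → 1 ≤ orbitLength f v
  orbitLength-positive v = proj₁ (orbitLength-least v)

  iter-orbitLength : ∀ v → iter (orbitLength f v) f v ≡ v
  iter-orbitLength v = ==⇒≡ (proj₁ (proj₂ (orbitLength-least v)))

  orbitLength-minimal : ∀ v {i} → 1 ≤ i → i < orbitLength f v → iter i f v ≢ v
  orbitLength-minimal v 1≤i i<L fⁱv≡v = proj₂ (proj₂ (orbitLength-least v)) 1≤i i<L (≡⇒== fⁱv≡v)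

  orbitLength-unique : ∀ v L → 1 ≤ L → iter L f v ≡ v → (∀ {i} → 1 ≤ i → i < L → iter i f v ≢ v) →
                       orbitLength f v ≡ L
  orbitLength-unique v L 1≤L fᴸv≡v minimal with <-cmp (orbitLength f v) L
  ... | tri< ℓ<L _ _ = contradiction (iter-orbitLength v) (minimal (orbitLength-positive v) ℓ<L)
  ... | tri≈ _ ℓ≡L _ = ℓ≡L
  ... | tri> _ _ L<ℓ = contradiction fᴸv≡v (orbitLength-minimal v 1≤L L<ℓ)

  iter-reduce : ∀ v i → ∃ λ r → r < orbitLength f v × iter i f v ≡ iter r f v
  iter-reduce v zero = 0 , orbitLength-positive v , refl
  iter-reduce v (suc i) with r , r<L , fⁱv≡fʳv ← iter-reduce v i with m≤n⇒m<n∨m≡n r<L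
  ... | inj₁ r+1<L = suc r , r+1<L , cong f fⁱv≡fʳv
  ... | inj₂ r+1≡L = 0 , orbitLength-positive v ,
                     trans (cong f fⁱv≡fʳv) (trans (cong (λ c → iter c f v) r+1≡L) (iter-orbitLength v))

  iter-injective-below : ∀ v {i j} → i < orbitLength f v → j < orbitLength f v →
                         iter i f v ≡ iter j f v → i ≡ j
  iter-injective-below v {i} {j} i<L j<L fⁱv≡fʲv with <-cmp i j
  ... | tri< i<j _ _ = contradiction (iter-cancel v i<j (sym fⁱv≡fʲv))
                                     (orbitLength-minimal v (m<n⇒0<n∸m i<j) (≤-<-trans (m∸n≤m j i) j<L))
  ... | tri≈ _ i≡j _ = i≡j
  ... | tri> _ _ j<i = contradiction (iter-cancel v j<i fⁱv≡fʲv)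
                                     (orbitLength-minimal v (m<n⇒0<n∸m j<i) (≤-<-trans (m∸n≤m i j) i<L))

  infix 4 _↝_
  _↝_ : Fin k → Fin k → Set
  v ↝ x = ∃ λ i → iter i f v ≡ x

  ↝-refl : ∀ {v} → v ↝ v
  ↝-refl = 0 , refl

  ↝-trans : ∀ {v x y} → v ↝ x → x ↝ y → v ↝ y
  ↝-trans {v} (i , refl) (j , refl) = j + i , iter-+ f j i v

  ↝-sym : ∀ {v x} → v ↝ x → x ↝ v
  ↝-sym {v} (i , refl) with r , r<L , fⁱv≡fʳv ← iter-reduce v i =
    orbitLength f v ∸ r ,
    trans (cong (iter (orbitLength f v ∸ r) f) fⁱv≡fʳv) (trans (iter-∸ v (<⇒≤ r<L)) (iter-orbitLength v))

  ↝-reduce : ∀ {v x} → v ↝ x → ∃ λ r → r < orbitLength f v × iter r f v ≡ x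
  ↝-reduce {v} (i , refl) with r , r<L , fⁱv≡fʳv ← iter-reduce v i = r , r<L , sym fⁱv≡fʳv

  orbitLength-↝ : ∀ {v x} → v ↝ x → orbitLength f x ≡ orbitLength f v
  orbitLength-↝ {v} (j , refl) =
    orbitLength-unique (iter j f v) (orbitLength f v) (orbitLength-positive v) returns minimal
    where
    returns : iter (orbitLength f v) f (iter j f v) ≡ iter j f v
    returns = trans (iter-comm f (orbitLength f v) j v) (cong (iter j f) (iter-orbitLength v))
    minimal : ∀ {i} → 1 ≤ i → i < orbitLength f v → iter i f (iter j f v) ≢ iter j f v
    minimal {i} 1≤i i<L e = orbitLength-minimal v 1≤i i<L (iter-injective j (trans (iter-comm f j i v) e))

  inOrbit⁻ : ∀ {v x} → T (inOrbit f v x) → v ↝ x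
  inOrbit⁻ {v} {x} h with i , _ , fⁱv==x ← any-upTo⁻ (λ i → iter i f v == x) (orbitLength f v) h =
    i , ==⇒≡ fⁱv==x

  inOrbit⁺ : ∀ {v x} → v ↝ x → T (inOrbit f v x)
  inOrbit⁺ {v} {x} (i , refl) with r , r<L , fⁱv≡fʳv ← iter-reduce v i =
    any-upTo⁺ (λ i → iter i f v == x) r<L (≡⇒== (sym fⁱv≡fʳv))

  isOrbitMinimum⁻ : ∀ {x y} → T (isOrbitMinimum f x) → x ↝ y → toℕ x ≤ toℕ y
  isOrbitMinimum⁻ {x} h (i , refl) with r , r<L , fⁱx≡fʳx ← iter-reduce x i =
    subst (λ z → toℕ x ≤ toℕ z) (sym fⁱx≡fʳx)
          (≤ᵇ⇒≤ _ _ (all-upTo⁻ (λ i → toℕ x ≤ᵇ toℕ (iter i f x)) (orbitLength f x) h r<L))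

  isOrbitMinimum⁺ : ∀ {x} → (∀ {y} → x ↝ y → toℕ x ≤ toℕ y) → T (isOrbitMinimum f x)
  isOrbitMinimum⁺ {x} minimal =
    all-upTo⁺ (λ i → toℕ x ≤ᵇ toℕ (iter i f x)) (orbitLength f x) λ {i} _ → ≤⇒≤ᵇ (minimal (i , refl))

  orbit-minimum : ∀ v → ∃ λ m → v ↝ m × (∀ {y} → v ↝ y → toℕ m ≤ toℕ y)
  orbit-minimum v = iter i₀ f v , (i₀ , refl) , least
    where
    key : ℕ → ℕ
    key i = toℕ (iter i f v)
    i₀ : ℕ
    i₀ = argmin key 0 (upTo (orbitLength f v))
    least : ∀ {y} → v ↝ y → toℕ (iter i₀ f v) ≤ toℕ y
    least (i , refl) with r , r<L , fⁱv≡fʳv ← iter-reduce v i =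
      subst (λ z → key i₀ ≤ toℕ z) (sym fⁱv≡fʳv)
            (lookup (f[argmin]≤f[xs] {f = key} 0 (upTo (orbitLength f v))) (∈-upTo⁺ r<L))

  tally-orbitMinimum : ∀ v → tally (λ x → inOrbit f v x ∧ isOrbitMinimum f x) ≡ 1
  tally-orbitMinimum v with m , v↝m , m-least ← orbit-minimum v = tally-singleton _ m pointwise
    where
    pointwise : ∀ x → (inOrbit f v x ∧ isOrbitMinimum f x) ≡ (x == m)
    pointwise x = T-injective (≡⇒== ∘ is-m ∘ Equivalence.to T-∧) (Equivalence.from T-∧ ∘ m-is ∘ ==⇒≡)
      where
      is-m : T (inOrbit f v x) × T (isOrbitMinimum f x) → x ≡ m
      is-m (x∈v , x-min) = toℕ-injective (≤-antisym (isOrbitMinimum⁻ x-min (↝-trans (↝-sym v↝x) v↝m))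
                                                   (m-least v↝x))
        where
        v↝x : v ↝ x
        v↝x = inOrbit⁻ x∈v
      m-is : x ≡ m → T (inOrbit f v x) × T (isOrbitMinimum f x)
      m-is refl = inOrbit⁺ v↝m , isOrbitMinimum⁺ (λ m↝y → m-least (↝-trans v↝m m↝y))

  tally-startsEvenCycle-orbit : ∀ v →
    tally (λ x → inOrbit f v x ∧ startsEvenCycle f x) ≡ bit (isEven (orbitLength f v))
  tally-startsEvenCycle-orbit v = trans (tally-cong pointwise) (by-parity (isEven (orbitLength f v)))
    where
    pointwise : ∀ x → (inOrbit f v x ∧ startsEvenCycle f x)
                      ≡ ((inOrbit f v x ∧ isOrbitMinimum f x) ∧ isEven (orbitLength f v))
    pointwise x with inOrbit f v x in x∈v
    ... | false = refl
    ... | true rewrite orbitLength-↝ (inOrbit⁻ (Equivalence.from T-≡ x∈v)) = refl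
    by-parity : ∀ e → tally (λ x → (inOrbit f v x ∧ isOrbitMinimum f x) ∧ e) ≡ bit e
    by-parity true  = trans (tally-cong (λ x → ∧-identityʳ (inOrbit f v x ∧ isOrbitMinimum f x)))
                            (tally-orbitMinimum v)
    by-parity false = tally-false _ (λ x → ∧-zeroʳ (inOrbit f v x ∧ isOrbitMinimum f x))

  evenCycleCount-outsideOrbit : ∀ v → evenCycleCount f ≡
    bit (isEven (orbitLength f v)) + tally (λ x → not (inOrbit f v x) ∧ startsEvenCycle f x)
  evenCycleCount-outsideOrbit v = begin
    evenCycleCount f                                         ≡⟨ count≡tally (startsEvenCycle f) ⟩
    tally (startsEvenCycle f)                                ≡⟨ tally-split (inOrbit f v) (startsEvenCycle f) ⟩
    tally (λ x → inOrbit f v x ∧ startsEvenCycle f x) + rest ≡⟨ cong (_+ rest) (tally-startsEvenCycle-orbit v) ⟩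
    bit (isEven (orbitLength f v)) + rest                    ∎
    where
    open ≡-Reasoning
    rest : ℕ
    rest = tally (λ x → not (inOrbit f v x) ∧ startsEvenCycle f x)

-- Composing a permutation with a transposition

startsEvenCycle-cong : ∀ {k} {f g : Fin k → Fin k} {x} → (∀ i → iter i g x ≡ iter i f x) →
                       startsEvenCycle g x ≡ startsEvenCycle f x
startsEvenCycle-cong {k} {f} {g} {x} same-iterates = cong₂ _∧_ same-minimality (cong isEven same-length)
  where
  same-length : orbitLength g x ≡ orbitLength f x
  same-length = search-cong (λ i → cong (_== x) (same-iterates i)) k 1
  same-minimality : isOrbitMinimum g x ≡ isOrbitMinimum f x
  same-minimality rewrite same-length =
    cong and (map-cong (λ i → cong (λ z → toℕ x ≤ᵇ toℕ z) (same-iterates i)) (upTo (orbitLength f x)))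

module Transposition {k} {f g : Fin k → Fin k}
  (f-injective : Injective _≡_ _≡_ f) (g-injective : Injective _≡_ _≡_ g)
  {a b : Fin k} (a≢b : a ≢ b) (g-a : g a ≡ f b) (g-b : g b ≡ f a)
  (g-other : ∀ {x} → x ≢ a × x ≢ b → g x ≡ f x) where

  module F = Orbit f-injective
  module G = Orbit g-injective

  Avoids : Fin k → Set
  Avoids z = z ≢ a × z ≢ b

  follows : ∀ {x y i} → g x ≡ f y → 1 ≤ i → (∀ {j} → 1 ≤ j → j < i → Avoids (iter j f y)) →
            iter i g x ≡ iter i f y
  follows {i = 1}           gx≡fy _ avoids = gx≡fy
  follows {i = suc (suc i)} gx≡fy _ avoids =
    trans (cong g (follows gx≡fy (s≤s z≤n) λ 1≤j j<i+1 → avoids 1≤j (m≤n⇒m≤1+n j<i+1)))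
          (g-other (avoids (s≤s z≤n) ≤-refl))

  -- With b = fᵖ a, the g-cycle of b is b, f a, …, fᵖ⁻¹ a and that of a is a, fᵖ⁺¹ a, …, fᴸ⁻¹ a.
  module Split (p : ℕ) (p<L : p < orbitLength f a) (fᵖa≡b : iter p f a ≡ b) where

    L : ℕ
    L = orbitLength f a

    q : ℕ
    q = L ∸ p

    q+p≡L : q + p ≡ L
    q+p≡L = m∸n+n≡m (<⇒≤ p<L)

    a↝b : a F.↝ b
    a↝b = p , fᵖa≡b

    p-positive : 1 ≤ p
    p-positive = n≢0⇒n>0 λ p≡0 → a≢b (trans (cong (λ c → iter c f a) (sym p≡0)) fᵖa≡b)

    avoids-below : ∀ {j} → 1 ≤ j → j < L → j ≢ p → Avoids (iter j f a)
    avoids-below 1≤j j<L j≢p =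
      F.orbitLength-minimal a 1≤j j<L ,
      λ fʲa≡b → j≢p (F.iter-injective-below a j<L p<L (trans fʲa≡b (sym fᵖa≡b)))

    iter-from-b : ∀ j → iter j f b ≡ iter (j + p) f a
    iter-from-b j = trans (cong (iter j f) (sym fᵖa≡b)) (sym (iter-+ f j p a))

    g-from-b : ∀ {i} → 1 ≤ i → i ≤ p → iter i g b ≡ iter i f a
    g-from-b 1≤i i≤p = follows g-b 1≤i λ 1≤j j<i →
      avoids-below 1≤j (<-trans (<-≤-trans j<i i≤p) p<L) (<⇒≢ (<-≤-trans j<i i≤p))

    g-from-a : ∀ {i} → 1 ≤ i → i + p ≤ L → iter i g a ≡ iter i f b
    g-from-a 1≤i i+p≤L = follows g-a 1≤i λ {j} 1≤j j<i → subst Avoids (sym (iter-from-b j))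
      (avoids-below (≤-trans 1≤j (m≤m+n j p)) (<-≤-trans (+-monoˡ-< p j<i) i+p≤L)
                    (λ j+p≡p → <⇒≢ (m<n+m p 1≤j) (sym j+p≡p)))

    orbitLength-g-b : orbitLength g b ≡ p
    orbitLength-g-b = G.orbitLength-unique b p p-positive (trans (g-from-b p-positive ≤-refl) fᵖa≡b)
      λ 1≤i i<p gⁱb≡b → proj₂ (avoids-below 1≤i (<-trans i<p p<L) (<⇒≢ i<p))
                              (trans (sym (g-from-b 1≤i (<⇒≤ i<p))) gⁱb≡b)

    orbitLength-g-a : orbitLength g a ≡ q
    orbitLength-g-a = G.orbitLength-unique a q (m<n⇒0<n∸m p<L) returns minimal
      where
      g≡f-shifted : ∀ {i} → 1 ≤ i → i + p ≤ L → iter i g a ≡ iter (i + p) f a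
      g≡f-shifted {i} 1≤i i+p≤L = trans (g-from-a 1≤i i+p≤L) (iter-from-b i)
      returns : iter q g a ≡ a
      returns = trans (g≡f-shifted (m<n⇒0<n∸m p<L) (≤-reflexive q+p≡L))
                      (trans (cong (λ c → iter c f a) q+p≡L) (F.iter-orbitLength a))
      minimal : ∀ {i} → 1 ≤ i → i < q → iter i g a ≢ a
      minimal {i} 1≤i i<q gⁱa≡a =
        F.orbitLength-minimal a (≤-trans 1≤i (m≤m+n i p)) i+p<L (trans (sym (g≡f-shifted 1≤i (<⇒≤ i+p<L))) gⁱa≡a)
        where
        i+p<L : i + p < L
        i+p<L = subst (i + p <_) q+p≡L (+-monoˡ-< p i<q)

    g-orbit-of-b⊆ : ∀ {x} → b G.↝ x → a F.↝ x
    g-orbit-of-b⊆ b↝x with G.↝-reduce b↝x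
    ... | zero  , _    , refl = a↝b
    ... | suc r , r<ℓb , refl =
      suc r , sym (g-from-b (s≤s z≤n) (<⇒≤ (subst (suc r <_) orbitLength-g-b r<ℓb)))

    g-orbit-of-a⊆ : ∀ {x} → a G.↝ x → a F.↝ x
    g-orbit-of-a⊆ a↝x with G.↝-reduce a↝x
    ... | zero  , _    , refl = F.↝-refl
    ... | suc r , r<ℓa , refl = F.↝-trans a↝b (suc r , sym (g-from-a (s≤s z≤n) r+1+p≤L))
      where
      r+1+p≤L : suc r + p ≤ L
      r+1+p≤L = subst (suc r + p ≤_) q+p≡L (+-monoˡ-≤ p (<⇒≤ (subst (suc r <_) orbitLength-g-a r<ℓa)))

    f-orbit-of-a⊆ : ∀ {x} → a F.↝ x → a G.↝ x ⊎ b G.↝ x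
    f-orbit-of-a⊆ a↝x with F.↝-reduce a↝x
    ... | zero  , _   , refl = inj₁ G.↝-refl
    ... | suc r , r<L , refl with suc r ≤? p
    ...   | yes r+1≤p = inj₂ (suc r , g-from-b (s≤s z≤n) r+1≤p)
    ...   | no  r+1≰p = inj₁ (suc r ∸ p , trans (g-from-a (m<n⇒0<n∸m p<r+1) shifted≤L) shifted-from-b)
      where
      p<r+1 : p < suc r
      p<r+1 = ≰⇒> r+1≰p
      shift : suc r ∸ p + p ≡ suc r
      shift = m∸n+n≡m (<⇒≤ p<r+1)
      shifted≤L : suc r ∸ p + p ≤ L
      shifted≤L = ≤-trans (≤-reflexive shift) (<⇒≤ r<L)
      shifted-from-b : iter (suc r ∸ p) f b ≡ iter (suc r) f a
      shifted-from-b = trans (iter-from-b (suc r ∸ p)) (cong (λ c → iter c f a) shift)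

    g-orbits-disjoint : ∀ {x} → a G.↝ x → b G.↝ x → ⊥
    g-orbits-disjoint a↝x b↝x with G.↝-reduce (G.↝-trans a↝x (G.↝-sym b↝x))
    ... | zero  , _    , a≡b  = a≢b a≡b
    ... | suc r , r<ℓa , gʳ⁺¹a≡b = <⇒≢ (m<n+m p (s≤s z≤n)) (sym r+1+p≡p)
      where
      r+1+p<L : suc r + p < L
      r+1+p<L = subst (suc r + p <_) q+p≡L (+-monoˡ-< p (subst (suc r <_) orbitLength-g-a r<ℓa))
      r+1+p≡p : suc r + p ≡ p
      r+1+p≡p = F.iter-injective-below a r+1+p<L p<L
        (trans (sym (trans (g-from-a (s≤s z≤n) (<⇒≤ r+1+p<L)) (iter-from-b (suc r)))) (trans gʳ⁺¹a≡b (sym fᵖa≡b)))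

    inOrbit-split : ∀ x → inOrbit f a x ≡ (inOrbit g a x ∨ inOrbit g b x)
    inOrbit-split x = T-injective
      (Equivalence.from T-∨ ∘ Sum.map G.inOrbit⁺ G.inOrbit⁺ ∘ f-orbit-of-a⊆ ∘ F.inOrbit⁻)
      (F.inOrbit⁺ ∘ [ g-orbit-of-a⊆ ∘ G.inOrbit⁻ , g-orbit-of-b⊆ ∘ G.inOrbit⁻ ]′ ∘ Equivalence.to T-∨)

    iter-outside : ∀ {x} → ¬ a F.↝ x → ∀ i → iter i g x ≡ iter i f x
    iter-outside x∉ zero        = refl
    iter-outside {x} x∉ (suc i) = follows {i = suc i} (g-other (avoids 0)) (s≤s z≤n) λ {j} _ _ → avoids j
      where
      avoids : ∀ j → Avoids (iter j f x)
      avoids j = (λ fʲx≡a → x∉ (F.↝-sym (j , fʲx≡a)))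
               , (λ fʲx≡b → x∉ (F.↝-trans a↝b (F.↝-sym (j , fʲx≡b))))

    tally-inside : tally (λ x → inOrbit f a x ∧ startsEvenCycle g x) ≡ bit (isEven q) + bit (isEven p)
    tally-inside = begin
      tally (λ x → inOrbit f a x ∧ startsEvenCycle g x)
        ≡⟨ tally-cong (λ x → cong (_∧ startsEvenCycle g x) (inOrbit-split x)) ⟩
      tally (λ x → (inOrbit g a x ∨ inOrbit g b x) ∧ startsEvenCycle g x)
        ≡⟨ tally-∨ (inOrbit g a) (inOrbit g b) (startsEvenCycle g)
                   (λ x x∈a x∈b → g-orbits-disjoint (G.inOrbit⁻ x∈a) (G.inOrbit⁻ x∈b)) ⟩
      tally (λ x → inOrbit g a x ∧ startsEvenCycle g x) + tally (λ x → inOrbit g b x ∧ startsEvenCycle g x)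
        ≡⟨ cong₂ _+_ (G.tally-startsEvenCycle-orbit a) (G.tally-startsEvenCycle-orbit b) ⟩
      bit (isEven (orbitLength g a)) + bit (isEven (orbitLength g b))
        ≡⟨ cong₂ (λ ℓa ℓb → bit (isEven ℓa) + bit (isEven ℓb)) orbitLength-g-a orbitLength-g-b ⟩
      bit (isEven q) + bit (isEven p) ∎
      where open ≡-Reasoning

    tally-outside : tally (λ x → not (inOrbit f a x) ∧ startsEvenCycle g x)
                  ≡ tally (λ x → not (inOrbit f a x) ∧ startsEvenCycle f x)
    tally-outside = tally-cong pointwise
      where
      pointwise : ∀ x → (not (inOrbit f a x) ∧ startsEvenCycle g x) ≡ (not (inOrbit f a x) ∧ startsEvenCycle f x)
      pointwise x with inOrbit f a x in x∈a
      ... | true  = refl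
      ... | false = startsEvenCycle-cong (iter-outside λ a↝x → subst T x∈a (F.inOrbit⁺ a↝x))

    rest : ℕ
    rest = tally (λ x → not (inOrbit f a x) ∧ startsEvenCycle f x)

    evenCycleCount-g : evenCycleCount g ≡ bit (isEven q) + bit (isEven p) + rest
    evenCycleCount-g = trans (count≡tally (startsEvenCycle g))
      (trans (tally-split (inOrbit f a) (startsEvenCycle g)) (cong₂ _+_ tally-inside tally-outside))

    evenCycleCount-flips : even (evenCycleCount g) ≡ not (even (evenCycleCount f))
    evenCycleCount-flips = begin
      even (evenCycleCount g)                       ≡⟨ cong even evenCycleCount-g ⟩
      even (halves + rest)                          ≡⟨ even-+-flip (bit (isEven L)) halves rest split-parity ⟩
      not (even (bit (isEven L) + rest))            ≡⟨ cong (not ∘ even) (F.evenCycleCount-outsideOrbit a) ⟨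
      not (even (evenCycleCount f))                 ∎
      where
      open ≡-Reasoning
      halves : ℕ
      halves = bit (isEven q) + bit (isEven p)
      split-parity : even halves ≡ not (even (bit (isEven L)))
      split-parity = subst (λ ℓ → even halves ≡ not (even (bit (isEven ℓ)))) q+p≡L (even-split-cycle p q)

  flips-when-linked : a F.↝ b → even (evenCycleCount g) ≡ not (even (evenCycleCount f))
  flips-when-linked a↝b with p , p<L , fᵖa≡b ← F.↝-reduce a↝b = Split.evenCycleCount-flips p p<L fᵖa≡b

  links-when-unlinked : ¬ a F.↝ b → a G.↝ b
  links-when-unlinked a↛b =
    orbitLength f b , trans (follows g-a (F.orbitLength-positive b) avoids) (F.iter-orbitLength b)
    where
    avoids : ∀ {j} → 1 ≤ j → j < orbitLength f b → Avoids (iter j f b)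
    avoids {j} 1≤j j<ℓ = (λ fʲb≡a → a↛b (F.↝-sym (j , fʲb≡a))) , F.orbitLength-minimal b 1≤j j<ℓ

evenCycleCount-transposed :
  ∀ {k} {f g : Fin k → Fin k} → Injective _≡_ _≡_ f → Injective _≡_ _≡_ g →
  ∀ {a b} → a ≢ b → g a ≡ f b → g b ≡ f a → (∀ {x} → x ≢ a × x ≢ b → g x ≡ f x) →
  even (evenCycleCount g) ≡ not (even (evenCycleCount f))
evenCycleCount-transposed {f = f} {g} f-injective g-injective {a} {b} a≢b g-a g-b g-other
  with T? (inOrbit f a b)
... | yes a∈b = Transposition.flips-when-linked f-injective g-injective a≢b g-a g-b g-other
                  (Orbit.inOrbit⁻ f-injective a∈b)
-- Otherwise the f-cycles of a and b merge into one g-cycle, which f splits back.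
... | no  a∉b = trans (sym (not-involutive _)) (cong not (sym (Transposition.flips-when-linked
                  g-injective f-injective a≢b (sym g-b) (sym g-a) (sym ∘ g-other)
                  (Transposition.links-when-unlinked f-injective g-injective a≢b g-a g-b g-other
                    (a∉b ∘ Orbit.inOrbit⁺ f-injective)))))

transpose-matchˡ : ∀ {k} (a b : Fin k) → transpose a b a ≡ b
transpose-matchˡ a b rewrite dec-true (a ≟ a) refl = refl

transpose-matchʳ : ∀ {k} (a b : Fin k) → transpose a b b ≡ a
transpose-matchʳ a b with b ≟ a
... | yes b≡a = b≡a
... | no  _ rewrite dec-true (b ≟ b) refl = refl

transpose-other : ∀ {k} {a b x : Fin k} → x ≢ a × x ≢ b → transpose a b x ≡ x
transpose-other {a = a} {b} {x} (x≢a , x≢b) rewrite dec-false (x ≟ a) x≢a | dec-false (x ≟ b) x≢b = refl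

∘-transpose : ∀ {k} {f g : Fin k → Fin k} {a b} → g a ≡ f b → g b ≡ f a →
              (∀ {x} → x ≢ a × x ≢ b → g x ≡ f x) → ∀ x → g x ≡ f (transpose a b x)
∘-transpose {f = f} {a = a} {b} g-a g-b g-other x with x ≟ a | x ≟ b
... | yes refl | _        = g-a
... | no  _    | yes refl rewrite dec-true (x ≟ x) refl = g-b
... | no  x≢a  | no  x≢b  rewrite dec-false (x ≟ b) x≢b = g-other (x≢a , x≢b)

transpose-injective : ∀ {k} (a b : Fin k) → Injective _≡_ _≡_ (transpose a b)
transpose-injective a b {x} {y} τx≡τy =
  trans (sym (transpose-inverse b a)) (trans (cong (transpose b a) τx≡τy) (transpose-inverse b a))

injective-∘-transpose : ∀ {k} {f g : Fin k → Fin k} {a b} → Injective _≡_ _≡_ f →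
                        (∀ x → g x ≡ f (transpose a b x)) → Injective _≡_ _≡_ g
injective-∘-transpose {a = a} {b} f-injective g≗fτ {x} {y} gx≡gy =
  transpose-injective a b (f-injective (trans (sym (g≗fτ x)) (trans gx≡gy (g≗fτ y))))

evenCycleCount-∘-transpose :
  ∀ {k} {f g : Fin k → Fin k} {a b} → Injective _≡_ _≡_ f → a ≢ b → (∀ x → g x ≡ f (transpose a b x)) →
  even (evenCycleCount g) ≡ not (even (evenCycleCount f))
evenCycleCount-∘-transpose {f = f} {g} {a} {b} f-injective a≢b g≗fτ =
  evenCycleCount-transposed f-injective (injective-∘-transpose f-injective g≗fτ) a≢b
    (trans (g≗fτ a) (cong f (transpose-matchˡ a b)))
    (trans (g≗fτ b) (cong f (transpose-matchʳ a b)))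
    (λ {x} x∉ab → trans (g≗fτ x) (cong f (transpose-other x∉ab)))

-- Definitionally, bijective G u₁ u₂ w₁ w₂ c is isBijection (π G u₁ u₂ w₁ w₂ c).
isBijection : ∀ {k} → (Fin k → Fin k) → Bool
isBijection {k} h = all (λ x → all (λ y → not (h x == h y) ∨ (x == y)) (allFin k)) (allFin k)
                  ∧ all (λ y → any (λ x → h x == y) (allFin k)) (allFin k)

isBijection⁻ : ∀ {k} {h : Fin k → Fin k} → T (isBijection h) →
               Injective _≡_ _≡_ h × (∀ y → ∃ λ x → h x ≡ y)
isBijection⁻ {k} {h} t with injective-test , surjective-test ← Equivalence.to T-∧ t = injective , surjective
  where
  injective : Injective _≡_ _≡_ h
  injective {x} {y} hx≡hy with Equivalence.to T-∨ (all-allFin⁻ _ (all-allFin⁻ _ injective-test x) y)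
  ... | inj₁ hx≠hy = ⊥-elim (subst (T ∘ not) (Equivalence.to T-≡ (≡⇒== hx≡hy)) hx≠hy)
  ... | inj₂ x==y  = ==⇒≡ x==y
  surjective : ∀ y → ∃ λ x → h x ≡ y
  surjective y with x , hx==y ← any-allFin⁻ _ (all-allFin⁻ _ surjective-test y) = x , ==⇒≡ hx==y

isBijection⁺ : ∀ {k} {h : Fin k → Fin k} → Injective _≡_ _≡_ h → (∀ y → ∃ λ x → h x ≡ y) → T (isBijection h)
isBijection⁺ {k} {h} injective surjective = Equivalence.from T-∧
  ( all-allFin⁺ _ (λ x → all-allFin⁺ _ (λ y → Equivalence.from T-∨ (injective-at x y)))
  , all-allFin⁺ _ (λ y → let x , hx≡y = surjective y in any-allFin⁺ _ x (≡⇒== hx≡y)))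
  where
  injective-at : ∀ x y → T (not (h x == h y)) ⊎ T (x == y)
  injective-at x y with x ≟ y
  ... | yes _   = inj₂ _
  ... | no  x≢y = inj₁ (Equivalence.from T-not-≡ (≢⇒==-false (x≢y ∘ injective)))

isBijection-∘-transpose⁺ : ∀ {k} {f g : Fin k → Fin k} {a b} → (∀ x → g x ≡ f (transpose a b x)) →
                           T (isBijection f) → T (isBijection g)
isBijection-∘-transpose⁺ {f = f} {g} {a} {b} g≗fτ t with f-injective , f-surjective ← isBijection⁻ {h = f} t =
  isBijection⁺ (injective-∘-transpose f-injective g≗fτ) g-surjective
  where
  g-surjective : ∀ y → ∃ λ x → g x ≡ y
  g-surjective y with x , fx≡y ← f-surjective y =
    transpose b a x , trans (g≗fτ (transpose b a x)) (trans (cong f (transpose-inverse a b {x})) fx≡y)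

isBijection-∘-transpose : ∀ {k} {f g : Fin k → Fin k} {a b} → (∀ x → g x ≡ f (transpose a b x)) →
                          isBijection g ≡ isBijection f
isBijection-∘-transpose {f = f} {g} {a} {b} g≗fτ =
  T-injective (isBijection-∘-transpose⁺ {f = g} {f} {b} {a} f≗gτ)
              (isBijection-∘-transpose⁺ {f = f} {g} {a} {b} g≗fτ)
  where
  f≗gτ : ∀ x → f x ≡ g (transpose b a x)
  f≗gτ x = sym (trans (g≗fτ (transpose b a x)) (cong f (transpose-inverse a b {x})))

-- The bracket

sum-filter-negate : ∀ {A : Set} (xs : List A) (P Q : A → Bool) (s t : A → ℤ) →
  (∀ x → Q x ≡ P x) → (∀ x → T (P x) → t x ≡ - s x) →
  foldr _+ℤ_ (+ 0) (map t (filter (λ x → Q x ≟ᵇ true) xs))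
    ≡ - foldr _+ℤ_ (+ 0) (map s (filter (λ x → P x ≟ᵇ true) xs))
sum-filter-negate []       P Q s t Q≗P t≗-s = refl
sum-filter-negate (x ∷ xs) P Q s t Q≗P t≗-s rewrite Q≗P x with P x in Px
... | true  = trans (cong₂ _+ℤ_ (t≗-s x (Equivalence.from T-≡ Px)) (sum-filter-negate xs P Q s t Q≗P t≗-s))
                    (sym (neg-distrib-+ (s x) _))
... | false = sum-filter-negate xs P Q s t Q≗P t≗-s

sign-flip : ∀ e e′ r r′ → even e′ ≡ not (even e) →
            (if isEven (e′ + r + r′) then + 1 else - + 1) ≡ - (if isEven (e + r + r′) then + 1 else - + 1)
sign-flip e e′ r r′ e′-flips
  rewrite isEven≡even (e′ + r + r′) | isEven≡even (e + r + r′)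
        | even-+-flip (e + r) (e′ + r) r′ (even-+-flip e e′ r e′-flips)
  with even (e + r + r′)
... | true  = refl
... | false = refl

module _ (G : SignedGraph) where
  open SignedGraph G using (n; m)

  stepFits : Bool → Maybe (Step m) → Fin n → Bool
  stepFits true  nothing  v = true
  stepFits true  (just _) v = false
  stepFits false nothing  v = false
  stepFits false (just s) v = start G s == v

  module _ (u₁ u₂ w₁ w₂ : Fin n) (c : Assignment G) where

    -- The test folded by wellShaped is local to Defs and cannot be named; matching on the two
    -- values it inspects makes it compute to stepFits.
    wellShaped⁻ : T (wellShaped G u₁ u₂ w₁ w₂ c) → ∀ v → T (stepFits (inU G u₁ u₂ w₁ w₂ c v) (c v) v)
    wellShaped⁻ t v with inU G u₁ u₂ w₁ w₂ c v | c v | all-allFin⁻ _ t v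
    ... | true  | nothing | fits = fits
    ... | true  | just _  | fits = fits
    ... | false | nothing | fits = fits
    ... | false | just _  | fits = fits

    wellShaped⁺ : (∀ v → T (stepFits (inU G u₁ u₂ w₁ w₂ c v) (c v) v)) → T (wellShaped G u₁ u₂ w₁ w₂ c)
    wellShaped⁺ fits with T? (wellShaped G u₁ u₂ w₁ w₂ c)
    ... | yes t = t
    ... | no ¬t with v , misfit ← Any.tabulate⁻ (¬All⇒Any¬ (λ v → T? _) _ (¬t ∘ All.all⁻ _))
                with inU G u₁ u₂ w₁ w₂ c v | c v | misfit | fits v
    ...   | true  | nothing | misfit | fit = ⊥-elim (misfit fit)
    ...   | true  | just _  | misfit | fit = ⊥-elim (misfit fit)
    ...   | false | nothing | misfit | fit = ⊥-elim (misfit fit)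
    ...   | false | just _  | misfit | fit = ⊥-elim (misfit fit)

  wellShaped-swapᵘ : ∀ u₁ u₂ w₁ w₂ c → wellShaped G u₁ u₂ w₁ w₂ c ≡ wellShaped G u₂ u₁ w₁ w₂ c
  wellShaped-swapᵘ u₁ u₂ w₁ w₂ c = T-injective
    (λ t → wellShaped⁺ u₂ u₁ w₁ w₂ c λ v → subst (λ b → T (stepFits b (c v) v)) (∨-comm (v == u₁) (v == u₂))
                                                 (wellShaped⁻ u₁ u₂ w₁ w₂ c t v))
    (λ t → wellShaped⁺ u₁ u₂ w₁ w₂ c λ v → subst (λ b → T (stepFits b (c v) v)) (∨-comm (v == u₂) (v == u₁))
                                                 (wellShaped⁻ u₂ u₁ w₁ w₂ c t v))

  π-at-u₁ : ∀ u₁ u₂ w₁ w₂ c → π G u₁ u₂ w₁ w₂ c u₁ ≡ w₁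
  π-at-u₁ u₁ u₂ w₁ w₂ c rewrite dec-true (u₁ ≟ u₁) refl = refl

  π-at-u₂ : ∀ u₁ u₂ w₁ w₂ c → u₁ ≢ u₂ → π G u₁ u₂ w₁ w₂ c u₂ ≡ w₂
  π-at-u₂ u₁ u₂ w₁ w₂ c u₁≢u₂ rewrite ≢⇒==-false (u₁≢u₂ ∘ sym) | dec-true (u₂ ≟ u₂) refl = refl

  π-outside : ∀ {u₁ u₂ w₁ w₂ u₁′ u₂′ w₁′ w₂′} c {x} → x ≢ u₁ × x ≢ u₂ → x ≢ u₁′ × x ≢ u₂′ →
              π G u₁ u₂ w₁ w₂ c x ≡ π G u₁′ u₂′ w₁′ w₂′ c x
  π-outside c (x≢u₁ , x≢u₂) (x≢u₁′ , x≢u₂′)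
    rewrite ≢⇒==-false x≢u₁ | ≢⇒==-false x≢u₂ | ≢⇒==-false x≢u₁′ | ≢⇒==-false x≢u₂′ = refl

  π-swapʷ : ∀ {u₁ u₂ w₁ w₂} → u₁ ≢ u₂ → ∀ c x → π G u₁ u₂ w₁ w₂ c x ≡ π G u₁ u₂ w₂ w₁ c (transpose u₁ u₂ x)
  π-swapʷ {u₁} {u₂} {w₁} {w₂} u₁≢u₂ c = ∘-transpose
    (trans (π-at-u₁ u₁ u₂ w₁ w₂ c) (sym (π-at-u₂ u₁ u₂ w₂ w₁ c u₁≢u₂)))
    (trans (π-at-u₂ u₁ u₂ w₁ w₂ c u₁≢u₂) (sym (π-at-u₁ u₁ u₂ w₂ w₁ c)))
    (λ x∉ → π-outside c x∉ x∉)

  π-swapᵘ : ∀ {u₁ u₂ w₁ w₂} → u₁ ≢ u₂ → ∀ c x → π G u₁ u₂ w₁ w₂ c x ≡ π G u₂ u₁ w₁ w₂ c (transpose u₁ u₂ x)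
  π-swapᵘ {u₁} {u₂} {w₁} {w₂} u₁≢u₂ c = ∘-transpose
    (trans (π-at-u₁ u₁ u₂ w₁ w₂ c) (sym (π-at-u₁ u₂ u₁ w₁ w₂ c)))
    (trans (π-at-u₂ u₁ u₂ w₁ w₂ c u₁≢u₂) (sym (π-at-u₂ u₂ u₁ w₁ w₂ c (u₁≢u₂ ∘ sym))))
    (λ (x≢u₁ , x≢u₂) → π-outside c (x≢u₁ , x≢u₂) (x≢u₂ , x≢u₁))

  bracketD-∘-transpose : ∀ {u₁ u₂ w₁ w₂ u₁′ u₂′ w₁′ w₂′ a b} → a ≢ b →
    (∀ c → wellShaped G u₁′ u₂′ w₁′ w₂′ c ≡ wellShaped G u₁ u₂ w₁ w₂ c) →
    (∀ c x → π G u₁′ u₂′ w₁′ w₂′ c x ≡ π G u₁ u₂ w₁ w₂ c (transpose a b x)) →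
    bracketD G u₁′ u₂′ w₁′ w₂′ ≡ - bracketD G u₁ u₂ w₁ w₂
  bracketD-∘-transpose {u₁} {u₂} {w₁} {w₂} {u₁′} {u₂′} {w₁′} {w₂′} a≢b same-shape π′≗πτ =
    sum-filter-negate (allAssignments G) (valid G u₁ u₂ w₁ w₂) (valid G u₁′ u₂′ w₁′ w₂′)
                      (sgnD G u₁ u₂ w₁ w₂) (sgnD G u₁′ u₂′ w₁′ w₂′) same-validity opposite-sign
    where
    same-validity : ∀ c → valid G u₁′ u₂′ w₁′ w₂′ c ≡ valid G u₁ u₂ w₁ w₂ c
    same-validity c = cong₂ _∧_ (same-shape c) (isBijection-∘-transpose {f = π G u₁ u₂ w₁ w₂ c} (π′≗πτ c))
    opposite-sign : ∀ c → T (valid G u₁ u₂ w₁ w₂ c) → sgnD G u₁′ u₂′ w₁′ w₂′ c ≡ - sgnD G u₁ u₂ w₁ w₂ c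
    -- nc and bs do not mention u₁ u₂ w₁ w₂, so both signs share them definitionally.
    opposite-sign c valid-c =
      sign-flip (ec G u₁ u₂ w₁ w₂ c) (ec G u₁′ u₂′ w₁′ w₂′ c) (nc G u₁ u₂ w₁ w₂ c) (bs G u₁ u₂ w₁ w₂ c)
        (evenCycleCount-∘-transpose π-injective a≢b (π′≗πτ c))
      where
      π-injective : Injective _≡_ _≡_ (π G u₁ u₂ w₁ w₂ c)
      π-injective = proj₁ (isBijection⁻ (proj₂ (Equivalence.to (T-∧ {wellShaped G u₁ u₂ w₁ w₂ c}) valid-c)))

lemma3p3 : (G : SignedGraph) (u₁ u₂ w₁ w₂ : Fin (SignedGraph.n G)) →
           u₁ ≢ u₂ →
           (bracketD G u₁ u₂ w₁ w₂ ≡ - bracketD G u₁ u₂ w₂ w₁)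
           × (bracketD G u₁ u₂ w₁ w₂ ≡ - bracketD G u₂ u₁ w₁ w₂)
lemma3p3 G u₁ u₂ w₁ w₂ u₁≢u₂ =
  bracketD-∘-transpose G u₁≢u₂ (λ c → refl) (π-swapʷ G u₁≢u₂) ,
  bracketD-∘-transpose G u₁≢u₂ (wellShaped-swapᵘ G u₁ u₂ w₁ w₂) (π-swapᵘ G u₁≢u₂)
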